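{- In $\lambda_{\circledR}\cap$: (i) $\Gamma\vdash\lambda x.M:\tau$ iff there exist $\alpha$ and $\sigma$ with $\tau\equiv\alpha\to\sigma$ and $\Gamma,x:\alpha\vdash M:\sigma$. (ii) $\Gamma\vdash MN:\sigma$ iff there exist $\Gamma'$, bases $\Delta_i$ and strict types $\tau_i$ ($i=0,\dots,n$) such that $\Gamma'\vdash M:\cap_{i=1}^n\tau_i\to\sigma$, $\Delta_i\vdash N:\tau_i$ for all $i\in\{0,\dots,n\}$, and $\Gamma=\Gamma',\Delta_0^{\top}\sqcap\Delta_1\sqcap\dots\sqcap\Delta_n$. (iii) $\Gamma\vdash z<^{x}_{y}M:\sigma$ iff there exist $\Gamma',\alpha,\beta$ with $\Gamma=\Gamma',z:\alpha\cap\beta$ and $\Gamma',x:\alpha,y:\beta\vdash M:\sigma$. (iv) $\Gamma\vdash x\odot M:\sigma$ iff $\Gamma=\Gamma',x:\top$ and $\Gamma'\vdash M:\sigma$.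
   Context: Terms. Fix a countably infinite set of variables. The set $\Lambda_{\circledR}$ of terms and $Fv(M)$ are defined simultaneously: every variable $x$ is a term with $Fv(x)=\{x\}$; $\lambda x.M$ is a term if $M$ is a term and $x\in Fv(M)$ ($Fv=Fv(M)\setminus\{x\}$); $MN$ is a term if $M,N$ are terms with $Fv(M)\cap Fv(N)=\emptyset$ ($Fv=Fv(M)\cup Fv(N)$); $x\odot M$ (erasure) is a term if $M$ is a term and $x\notin Fv(M)$ ($Fv=\{x\}\cup Fv(M)$); $x<^{x_1}_{x_2}M$ (duplication) is a term if $M$ is a term, $x_1,x_2\in Fv(M)$, $x_1\neq x_2$, $x\notin Fv(M)\setminus\{x_1,x_2\}$ ($Fv=\{x\}\cup(Fv(M)\setminus\{x_1,x_2\})$). Types. Strict types $\sigma::=p\mid\alpha\to\sigma$; types $\alpha::=\cap_{i=1}^n\sigma_i$ ($=\top$ if $n=0$), with $\cap$ commutative, associative, $\top$ neutral. A basis $\Gamma$ maps a finite set $Dom(\Gamma)$ of variables to types; $\Gamma,x:\alpha$ extends by $x\notin Dom(\Gamma)$; for $Dom(\Gamma)=Dom(\Delta)$, $(\Gamma\sqcap\Delta)(x)=\Gamma(x)\cap\Delta(x)$; $\Gamma^{\top}$ maps $Dom(\Gamma)$ to $\top$. Rules of $\lambda_{\circledR}\cap$: (Ax) $x:\sigma\vdash x:\sigma$; ($\to_I$) from $\Gamma,x:\alpha\vdash M:\sigma$ infer $\Gamma\vdash\lambda x.M:\alpha\to\sigma$; ($\to_E$) from $\Gamma\vdash M:\cap_{i=1}^n\tau_i\to\sigma$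 and $\Delta_0\vdash N:\tau_0,\dots,\Delta_n\vdash N:\tau_n$ infer $\Gamma,\Delta_0^{\top}\sqcap\Delta_1\sqcap\dots\sqcap\Delta_n\vdash MN:\sigma$; (Cont) from $\Gamma,x:\alpha,y:\beta\vdash M:\sigma$ infer $\Gamma,z:\alpha\cap\beta\vdash z<^{x}_{y}M:\sigma$; (Thin) from $\Gamma\vdash M:\sigma$ infer $\Gamma,x:\top\vdash x\odot M:\sigma$. -}

module Defs where

open import Data.Nat using (ℕ; _≟_)
open import Data.List using (List; []; _∷_; _++_; map; filter; foldl)
open import Data.List.Membership.Propositional using (_∈_; _∉_)
open import Data.List.Relation.Binary.Disjoint.Propositional using (Disjoint)
open import Data.List.Relation.Unary.All using (All)
open import Data.Maybe using (Maybe; just; nothing; fromMaybe)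
open import Data.Maybe.Relation.Binary.Pointwise using (Pointwise)
open import Data.Product using (_×_; _,_; proj₁; proj₂)
open import Data.Sum using (_⊎_)
open import Relation.Nullary using (¬_; yes; no)
open import Relation.Nullary.Decidable using (¬?)
open import Relation.Binary.PropositionalEquality using (_≡_)

Var : Set
Var = ℕ

data Term : Set where
  var   : Var → Term
  lam   : Var → Term → Term
  app   : Term → Term → Term
  erase : Var → Term → Term
  dup   : Var → Var → Var → Term → Term    -- dup z x y M  is  z <^x_y M

Fv : Term → List Var
Fv (var x)       = x ∷ []
Fv (lam x M)     = filter (λ v → ¬? (v ≟ x)) (Fv M)
Fv (app M N)     = Fv M ++ Fv N
Fv (erase x M)   = x ∷ Fv M
Fv (dup z x y M) = z ∷ filter (λ v → ¬? (v ≟ y)) (filter (λ v → ¬? (v ≟ x)) (Fv M))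

-- membership in Λ® (the resource-control well-formedness conditions)
data WF : Term → Set where
  wf-var   : ∀ x → WF (var x)
  wf-lam   : ∀ x M → WF M → x ∈ Fv M → WF (lam x M)
  wf-app   : ∀ M N → WF M → WF N → Disjoint (Fv M) (Fv N) → WF (app M N)
  wf-erase : ∀ x M → WF M → x ∉ Fv M → WF (erase x M)
  wf-dup   : ∀ z x y M → WF M → x ∈ Fv M → y ∈ Fv M → ¬ (x ≡ y) →
             z ∉ filter (λ v → ¬? (v ≟ y)) (filter (λ v → ¬? (v ≟ x)) (Fv M)) →
             WF (dup z x y M)

-- Types: strict types σ ::= p | α → σ ; types α = ∩ σᵢ as lists
-- (⊤ = [], ∩ = _++_), identified up to commutativity/associativity.

data SType : Set where
  atom : ℕ → SType
  _⇒_  : List SType → SType → SType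

Ty : Set
Ty = List SType

infixr 5 _⇒_
infix 4 _≈ₛ_ _≈ᵢ_ _≈ᵇ_

mutual
  data _≈ₛ_ : SType → SType → Set where
    atom-≈ : ∀ p → atom p ≈ₛ atom p
    ⇒-≈    : ∀ {α β σ τ} → α ≈ᵢ β → σ ≈ₛ τ → (α ⇒ σ) ≈ₛ (β ⇒ τ)

  data _≈ᵢ_ : Ty → Ty → Set where
    nil-≈   : [] ≈ᵢ []
    cons-≈  : ∀ {σ τ α β} → σ ≈ₛ τ → α ≈ᵢ β → (σ ∷ α) ≈ᵢ (τ ∷ β)
    swap-≈  : ∀ σ τ α → (σ ∷ τ ∷ α) ≈ᵢ (τ ∷ σ ∷ α)
    trans-≈ : ∀ {α β γ} → α ≈ᵢ β → β ≈ᵢ γ → α ≈ᵢ γ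

-- Bases: association lists, read through lookupB (finite maps Var → Ty)

Basis : Set
Basis = List (Var × Ty)

lookupB : Basis → Var → Maybe Ty
lookupB []            x = nothing
lookupB ((y , α) ∷ Γ) x with x ≟ y
... | yes _ = just α
... | no  _ = lookupB Γ x

Fresh : Var → Basis → Set
Fresh x Γ = lookupB Γ x ≡ nothing

_≈ᵇ_ : Basis → Basis → Set
Γ ≈ᵇ Δ = ∀ x → Pointwise _≈ᵢ_ (lookupB Γ x) (lookupB Δ x)

SameDom : Basis → Basis → Set
SameDom Γ Δ = ∀ x → (Fresh x Γ → Fresh x Δ) × (Fresh x Δ → Fresh x Γ)

DisjointB : Basis → Basis → Set
DisjointB Γ Δ = ∀ x → Fresh x Γ ⊎ Fresh x Δ

-- Γ , x : α   (used only under the side condition Fresh x Γ)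
_,_∶_ : Basis → Var → Ty → Basis
Γ , x ∶ α = (x , α) ∷ Γ

-- Γ , Δ      (used only under the side condition DisjointB Γ Δ)
_,,_ : Basis → Basis → Basis
Γ ,, Δ = Γ ++ Δ

-- Γ ⊓ Δ      (used only under the side condition SameDom Γ Δ)
_⊓_ : Basis → Basis → Basis
Γ ⊓ Δ = map (λ p → proj₁ p , proj₂ p ++ fromMaybe [] (lookupB Δ (proj₁ p))) Γ

_ᵀ : Basis → Basis
Γ ᵀ = map (λ p → proj₁ p , []) Γ

meetAll : Basis → List Basis → Basis
meetAll Δ₀ Δs = foldl _⊓_ (Δ₀ ᵀ) Δs

infixl 4 _,_∶_ _,,_
infixl 5 _⊓_

-- The type system λ®∩.  Types are considered modulo ≈ (as in the paper);
-- this is realised by the conversion rule `conv`.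

infix 3 _⊢_∶_

data _⊢_∶_ : Basis → Term → SType → Set where
  ax   : ∀ x σ → ([] , x ∶ (σ ∷ [])) ⊢ var x ∶ σ
  →I   : ∀ {Γ x α M σ} → Fresh x Γ → (Γ , x ∶ α) ⊢ M ∶ σ → Γ ⊢ lam x M ∶ (α ⇒ σ)
  -- premises: Γ ⊢ M : ∩ᵢ τᵢ → σ ; Δ₀ ⊢ N : τ₀ ; Δᵢ ⊢ N : τᵢ (ds = [(Δᵢ , τᵢ)]ᵢ₌₁ⁿ)
  →E   : ∀ {Γ M N σ Δ₀ τ₀} (ds : List (Basis × SType)) →
         Γ ⊢ M ∶ (map proj₂ ds ⇒ σ) →
         Δ₀ ⊢ N ∶ τ₀ →
         All (λ d → proj₁ d ⊢ N ∶ proj₂ d) ds →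
         All (λ d → SameDom Δ₀ (proj₁ d)) ds →
         DisjointB Γ Δ₀ →
         (Γ ,, meetAll Δ₀ (map proj₁ ds)) ⊢ app M N ∶ σ
  cont : ∀ {Γ x y z α β M σ} → Fresh x Γ → Fresh y (Γ , x ∶ α) → Fresh z Γ →
         (Γ , x ∶ α , y ∶ β) ⊢ M ∶ σ → (Γ , z ∶ (α ++ β)) ⊢ dup z x y M ∶ σ
  thin : ∀ {Γ x M σ} → Fresh x Γ → Γ ⊢ M ∶ σ → (Γ , x ∶ []) ⊢ erase x M ∶ σ
  conv : ∀ {Γ Γ' M σ σ'} → Γ ⊢ M ∶ σ → Γ ≈ᵇ Γ' → σ ≈ₛ σ' → Γ' ⊢ M ∶ σ'

module Submission where

-- The only rule that is not syntax-directed is the conversion rule `conv`,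
-- which changes the basis along ≈ᵇ and the type along ≈ₛ.  So the proof is:
--   1. ≈ₛ, ≈ᵢ and ≈ᵇ are equivalence relations, and ≈ᵇ respects freshness
--      and extension of a basis;
--   2. for each term former we name the "shape" of its typings (the
--      right-hand side of the equivalence) and show that this shape is
--      closed under conversion;
--   3. inversion then goes by induction on the derivation: the
--      syntax-directed rule yields the shape directly, and a `conv` step is
--      absorbed by closure under conversion;
--   4. conversely, every shape is derivable by its rule followed by `conv`.

open import Defs
open import Data.List using ([]; _∷_; _++_; map)
open import Data.List.Relation.Unary.All using (All)
open import Data.Maybe.Relation.Binary.Pointwise as Pointwise using (Pointwise; just)
open import Data.Nat using (_≟_)
open import Data.Product using (_×_; _,_; proj₁; proj₂; ∃-syntax)
open import Function.Bundles using (_⇔_; mk⇔)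
open import Relation.Binary.PropositionalEquality using (subst)
open import Relation.Nullary using (yes; no)

mutual
  reflₛ : ∀ σ → σ ≈ₛ σ
  reflₛ (atom p) = atom-≈ p
  reflₛ (α ⇒ σ)  = ⇒-≈ (reflᵢ α) (reflₛ σ)

  reflᵢ : ∀ α → α ≈ᵢ α
  reflᵢ []      = nil-≈
  reflᵢ (σ ∷ α) = cons-≈ (reflₛ σ) (reflᵢ α)

mutual
  symₛ : ∀ {σ τ} → σ ≈ₛ τ → τ ≈ₛ σ
  symₛ (atom-≈ p) = atom-≈ p
  symₛ (⇒-≈ a b)  = ⇒-≈ (symᵢ a) (symₛ b)

  symᵢ : ∀ {α β} → α ≈ᵢ β → β ≈ᵢ α
  symᵢ nil-≈          = nil-≈
  symᵢ (cons-≈ a b)   = cons-≈ (symₛ a) (symᵢ b)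
  symᵢ (swap-≈ σ τ α) = swap-≈ τ σ α
  symᵢ (trans-≈ a b)  = trans-≈ (symᵢ b) (symᵢ a)

transₛ : ∀ {σ τ ρ} → σ ≈ₛ τ → τ ≈ₛ ρ → σ ≈ₛ ρ
transₛ (atom-≈ p) (atom-≈ .p) = atom-≈ p
transₛ (⇒-≈ a b)  (⇒-≈ c d)   = ⇒-≈ (trans-≈ a c) (transₛ b d)

reflᵇ : ∀ Γ → Γ ≈ᵇ Γ
reflᵇ Γ x = Pointwise.refl (reflᵢ _)

-- A conversion Γ₀ ≈ᵇ Γ can be transported along an equivalence Γ₀ ≈ᵇ Θ:
-- this is the form in which symmetry and transitivity are used below.
reroot : ∀ Γ₀ Γ Θ → Γ₀ ≈ᵇ Γ → Γ₀ ≈ᵇ Θ → Γ ≈ᵇ Θ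
reroot Γ₀ Γ Θ e f x = Pointwise.trans trans-≈ (Pointwise.sym symᵢ (e x)) (f x)

extᵇ : ∀ Γ Δ x α → Γ ≈ᵇ Δ → (Γ , x ∶ α) ≈ᵇ (Δ , x ∶ α)
extᵇ Γ Δ x α e v with v ≟ x
... | yes _ = just (reflᵢ α)
... | no  _ = e v

freshᵇ : ∀ Γ Δ x → Γ ≈ᵇ Δ → Fresh x Γ → Fresh x Δ
freshᵇ Γ Δ x e fresh =
  Pointwise.nothing-inv (subst (λ m → Pointwise _≈ᵢ_ m (lookupB Δ x)) fresh (e x))

ConvClosed : (Basis → SType → Set) → Set
ConvClosed P = ∀ Γ Γ' {σ σ'} → Γ ≈ᵇ Γ' → σ ≈ₛ σ' → P Γ σ → P Γ' σ'

LamShape : Var → Term → Basis → SType → Set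
LamShape x M Γ τ =
  ∃[ α ] ∃[ σ ] (τ ≈ₛ (α ⇒ σ)) × Fresh x Γ × ((Γ , x ∶ α) ⊢ M ∶ σ)

AppShape : Term → Term → Basis → SType → Set
AppShape M N Γ σ =
  ∃[ Γ' ] ∃[ Δ₀ ] ∃[ τ₀ ] ∃[ ds ]
    (Γ' ⊢ M ∶ (map proj₂ ds ⇒ σ))
    × (Δ₀ ⊢ N ∶ τ₀)
    × All (λ d → proj₁ d ⊢ N ∶ proj₂ d) ds
    × All (λ d → SameDom Δ₀ (proj₁ d)) ds
    × DisjointB Γ' Δ₀
    × (Γ ≈ᵇ (Γ' ,, meetAll Δ₀ (map proj₁ ds)))

DupShape : Var → Var → Var → Term → Basis → SType → Set
DupShape z x y M Γ σ =
  ∃[ Γ' ] ∃[ α ] ∃[ β ]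
    Fresh z Γ' × (Γ ≈ᵇ (Γ' , z ∶ (α ++ β)))
    × Fresh x Γ' × Fresh y (Γ' , x ∶ α)
    × ((Γ' , x ∶ α , y ∶ β) ⊢ M ∶ σ)

EraseShape : Var → Term → Basis → SType → Set
EraseShape x M Γ σ =
  ∃[ Γ' ] Fresh x Γ' × (Γ ≈ᵇ (Γ' , x ∶ [])) × (Γ' ⊢ M ∶ σ)

-- For an abstraction the converted basis is
-- passed into the body's typing and the arrow type absorbs the type
-- conversion; for the other formers the basis equivalence is recorded in
-- the shape and the type conversion is passed to the premise typing M.

lamShape-conv : ∀ x M → ConvClosed (LamShape x M)
lamShape-conv x M Γ Γ' e s (α , σ , τ≈ , fresh , d) =
  α , σ , transₛ (symₛ s) τ≈ , freshᵇ Γ Γ' x e fresh ,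
  conv d (extᵇ Γ Γ' x α e) (reflₛ σ)

appShape-conv : ∀ M N → ConvClosed (AppShape M N)
appShape-conv M N Γ Γ' e s (Γ₁ , Δ₀ , τ₀ , ds , dM , dN , dNs , doms , disj , e₁) =
  Γ₁ , Δ₀ , τ₀ , ds , conv dM (reflᵇ Γ₁) (⇒-≈ (reflᵢ _) s) , dN , dNs , doms , disj ,
  reroot Γ Γ' (Γ₁ ,, meetAll Δ₀ (map proj₁ ds)) e e₁

dupShape-conv : ∀ z x y M → ConvClosed (DupShape z x y M)
dupShape-conv z x y M Γ Γ' e s (Γ₁ , α , β , fz , e₁ , fx , fy , d) =
  Γ₁ , α , β , fz , reroot Γ Γ' (Γ₁ , z ∶ (α ++ β)) e e₁ , fx , fy ,
  conv d (reflᵇ (Γ₁ , x ∶ α , y ∶ β)) s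

eraseShape-conv : ∀ x M → ConvClosed (EraseShape x M)
eraseShape-conv x M Γ Γ' e s (Γ₁ , fresh , e₁ , d) =
  Γ₁ , fresh , reroot Γ Γ' (Γ₁ , x ∶ []) e e₁ , conv d (reflᵇ Γ₁) s

-- Inversion: a derivation of a given term former ends with its own rule
-- followed by conversions, and both preserve the shape.

lamInv : ∀ {Γ x M τ} → Γ ⊢ lam x M ∶ τ → LamShape x M Γ τ
lamInv (→I {α = α} {σ = σ} fresh d) = α , σ , reflₛ (α ⇒ σ) , fresh , d
lamInv (conv {Γ = Γ₀} {Γ' = Γ} d e s) = lamShape-conv _ _ Γ₀ Γ e s (lamInv d)

appInv : ∀ {Γ M N σ} → Γ ⊢ app M N ∶ σ → AppShape M N Γ σ
appInv (→E {Γ = Γ} {Δ₀ = Δ₀} {τ₀ = τ₀} ds dM dN dNs doms disj) =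
  Γ , Δ₀ , τ₀ , ds , dM , dN , dNs , doms , disj , reflᵇ (Γ ,, meetAll Δ₀ (map proj₁ ds))
appInv (conv {Γ = Γ₀} {Γ' = Γ} d e s) = appShape-conv _ _ Γ₀ Γ e s (appInv d)

dupInv : ∀ {Γ z x y M σ} → Γ ⊢ dup z x y M ∶ σ → DupShape z x y M Γ σ
dupInv (cont {Γ = Γ} {z = z} {α = α} {β = β} fx fy fz d) =
  Γ , α , β , fz , reflᵇ (Γ , z ∶ (α ++ β)) , fx , fy , d
dupInv (conv {Γ = Γ₀} {Γ' = Γ} d e s) = dupShape-conv _ _ _ _ Γ₀ Γ e s (dupInv d)

eraseInv : ∀ {Γ x M σ} → Γ ⊢ erase x M ∶ σ → EraseShape x M Γ σ
eraseInv (thin {Γ = Γ} {x = x} fresh d) = Γ , fresh , reflᵇ (Γ , x ∶ []) , d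
eraseInv (conv {Γ = Γ₀} {Γ' = Γ} d e s) = eraseShape-conv _ _ Γ₀ Γ e s (eraseInv d)

lamIntro : ∀ {Γ x M τ} → LamShape x M Γ τ → Γ ⊢ lam x M ∶ τ
lamIntro {Γ} (α , σ , τ≈ , fresh , d) = conv (→I fresh d) (reflᵇ Γ) (symₛ τ≈)

appIntro : ∀ {Γ M N σ} → AppShape M N Γ σ → Γ ⊢ app M N ∶ σ
appIntro {Γ} {σ = σ} (Γ' , Δ₀ , τ₀ , ds , dM , dN , dNs , doms , disj , e) =
  conv (→E ds dM dN dNs doms disj)
       (reroot Γ (Γ' ,, meetAll Δ₀ (map proj₁ ds)) Γ e (reflᵇ Γ)) (reflₛ σ)

dupIntro : ∀ {Γ z x y M σ} → DupShape z x y M Γ σ → Γ ⊢ dup z x y M ∶ σ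
dupIntro {Γ} {z} {σ = σ} (Γ' , α , β , fz , e , fx , fy , d) =
  conv (cont fx fy fz d) (reroot Γ (Γ' , z ∶ (α ++ β)) Γ e (reflᵇ Γ)) (reflₛ σ)

eraseIntro : ∀ {Γ x M σ} → EraseShape x M Γ σ → Γ ⊢ erase x M ∶ σ
eraseIntro {Γ} {x} {σ = σ} (Γ' , fresh , e , d) =
  conv (thin fresh d) (reroot Γ (Γ' , x ∶ []) Γ e (reflᵇ Γ)) (reflₛ σ)

mainTheorem14 :
    (∀ Γ x M τ → WF (lam x M) →
      (Γ ⊢ lam x M ∶ τ) ⇔
      (∃[ α ] ∃[ σ ] (τ ≈ₛ (α ⇒ σ)) × Fresh x Γ × ((Γ , x ∶ α) ⊢ M ∶ σ)))
    ×
    (∀ Γ M N σ → WF (app M N) →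
      (Γ ⊢ app M N ∶ σ) ⇔
      (∃[ Γ' ] ∃[ Δ₀ ] ∃[ τ₀ ] ∃[ ds ]
        (Γ' ⊢ M ∶ (map proj₂ ds ⇒ σ))
        × (Δ₀ ⊢ N ∶ τ₀)
        × All (λ d → proj₁ d ⊢ N ∶ proj₂ d) ds
        × All (λ d → SameDom Δ₀ (proj₁ d)) ds
        × DisjointB Γ' Δ₀
        × (Γ ≈ᵇ (Γ' ,, meetAll Δ₀ (map proj₁ ds)))))
    ×
    (∀ Γ z x y M σ → WF (dup z x y M) →
      (Γ ⊢ dup z x y M ∶ σ) ⇔
      (∃[ Γ' ] ∃[ α ] ∃[ β ]
        Fresh z Γ' × (Γ ≈ᵇ (Γ' , z ∶ (α ++ β)))
        × Fresh x Γ' × Fresh y (Γ' , x ∶ α)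
        × ((Γ' , x ∶ α , y ∶ β) ⊢ M ∶ σ)))
    ×
    (∀ Γ x M σ → WF (erase x M) →
      (Γ ⊢ erase x M ∶ σ) ⇔
      (∃[ Γ' ] Fresh x Γ' × (Γ ≈ᵇ (Γ' , x ∶ [])) × (Γ' ⊢ M ∶ σ)))
mainTheorem14 =
    (λ _ _ _ _ _ → mk⇔ lamInv lamIntro)
  , (λ _ _ _ _ _ → mk⇔ appInv appIntro)
  , (λ _ _ _ _ _ _ _ → mk⇔ dupInv dupIntro)
  , (λ _ _ _ _ _ → mk⇔ eraseInv eraseIntro)
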